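{- For every positive integer $r$ and all nonnegative integers $n$ and $j$, \[ \sum_{k=j}^{n}\binom{n+r}{k+r}{k+r\brace j+r}B_{n-k}^{(r)}=\frac{\binom{n+r}{r}}{\binom{j+r}{r}}{n\brace j}. \] In particular, \[ \sum_{k=j}^{n}\binom{n+1}{k+1}{k+1\brace j+1}B_{n-k}=\frac{n+1}{j+1}{n\brace j}. \]
   Context: ${n\brace k}$ denotes the Stirling number of the second kind. The higher-order Bernoulli numbers $B_n^{(r)}$ are defined by $\sum_{n\ge0}B_n^{(r)}t^n/n!=\bigl(t/(e^t-1)\bigr)^r$, and $B_n=B_n^{(1)}$. -}

module Defs where

open import Data.Nat as ℕ using (ℕ; zero; suc; _∸_; _≤_; _<_; z≤n; s≤s; NonZero)
open import Data.Nat.Properties using (≤-trans; m≤m+n; m≤n+m)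
open import Data.Nat.Combinatorics using (_C_; nCk+nC[k+1]≡[n+1]C[k+1])
open import Data.Nat using (_!)
open import Data.Integer using (+_)
open import Data.Rational using (ℚ; 0ℚ; 1ℚ; _+_; _*_; -_; _/_)
open import Relation.Binary.PropositionalEquality using (subst)
open import Data.Nat.Properties using (_!≢0)
open import Data.List using (List; []; _∷_; head)
open import Data.Maybe using (fromMaybe)

-- Finite sums  Σ_{k=j}^{n} f k  (empty when n < j)

sumFromTo : ℕ → ℕ → (ℕ → ℚ) → ℚ
sumFromTo j n f = go (suc n ∸ j)
  where
  go : ℕ → ℚ
  go zero    = 0ℚ
  go (suc i) = go i + f (j ℕ.+ i)

sumTo : ℕ → (ℕ → ℚ) → ℚ
sumTo n f = sumFromTo 0 n f

ℕ→ℚ : ℕ → ℚ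
ℕ→ℚ n = (+ n) / 1

stirling2 : ℕ → ℕ → ℕ
stirling2 zero    zero    = 1
stirling2 zero    (suc k) = 0
stirling2 (suc n) zero    = 0
stirling2 (suc n) (suc k) = suc k ℕ.* stirling2 n (suc k) ℕ.+ stirling2 n k

Series : Set
Series = ℕ → ℚ

_⊛_ : Series → Series → Series
(a ⊛ b) n = sumTo n (λ i → a i * b (n ∸ i))

oneS : Series
oneS zero    = 1ℚ
oneS (suc n) = 0ℚ

_^S_ : Series → ℕ → Series
a ^S zero  = oneS
a ^S suc r = a ⊛ (a ^S r)

-- coefficients of (e^t - 1)/t = Σ_n t^n/(n+1)!
expm1OverT : Series
expm1OverT n = (+ 1) / (suc n !) where instance _ = (suc n) !≢0

-- multiplicative inverse of a series with constant term 1: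
-- c 0 = 1,  c (n+1) = - Σ_{i=1}^{n+1} a i * c (n+1-i).
-- invPrefix a n = [c n , c (n-1) , … , c 0]
private
  weighted : Series → ℕ → List ℚ → ℚ
  weighted a m []       = 0ℚ
  weighted a m (x ∷ xs) = a (suc m) * x + weighted a (suc m) xs

invPrefix : Series → ℕ → List ℚ
invPrefix a zero    = 1ℚ ∷ []
invPrefix a (suc n) = let L = invPrefix a n in (- weighted a 0 L) ∷ L

invS : Series → Series
invS a n = fromMaybe 0ℚ (head (invPrefix a n))

tOverExpm1 : Series
tOverExpm1 = invS expm1OverT

bernoulliHO : ℕ → ℕ → ℚ
bernoulliHO r n = ℕ→ℚ (n !) * ((tOverExpm1 ^S r) n)

bernoulli : ℕ → ℚ
bernoulli n = bernoulliHO 1 n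

nCk>0 : ∀ n k → k ≤ n → 0 < n C k
nCk>0 zero    zero    _ = s≤s z≤n
nCk>0 (suc n) zero    _ = s≤s z≤n
nCk>0 (suc n) (suc k) (s≤s k≤n) =
  subst (0 <_) (nCk+nC[k+1]≡[n+1]C[k+1] n k)
        (≤-trans (nCk>0 n k k≤n) (m≤m+n (n C k) (n C suc k)))

binomNonZero : ∀ j r → NonZero ((j ℕ.+ r) C r)
binomNonZero j r = ℕ.>-nonZero (nCk>0 (j ℕ.+ r) r (m≤n+m r j))

-- Let E = (e^t − 1)/t and T = t/(e^t − 1), so that E T = 1. As (e^t − 1)^k = t^k E^k
-- is the exponential generating function of k! S(n, k), which follows from
-- S(n+1, k+1) = Σ_l C(n, l) S(l, k), we get n! [t^(n−k)] E^k = k! S(n, k).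
-- Multiplying the coefficient of t^(n−j) in E^(j+r) T^r = E^j by (n + r)! gives
-- (j + r)! Σ_k C(n+r, k+r) S(k+r, j+r) B_(n−k)^(r) on the left and (n + r)! j! S(n, j) / n!
-- on the right; dividing by (j + r)! yields the identity, and r = 1 is the case of B_n.
module Submission where

open import Defs
open import Data.Nat using (ℕ; suc; _∸_; NonZero)
open import Data.Nat.Combinatorics using (_C_)
open import Data.Integer using (+_)
open import Data.Rational using (ℚ; _*_; _/_)
open import Data.Product using (_×_)
open import Relation.Binary.PropositionalEquality using (_≡_)

open import Algebra.Bundles using (CommutativeMonoid)
import Algebra.Properties.CommutativeMonoid.Mult as MonoidPower
import Algebra.Properties.Group as GroupProperties
import Relation.Binary.Reasoning.Setoid as SetoidReasoning
open import Data.List using (List; []; _∷_)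
open import Data.Nat as ℕ using (zero; 2+; _≤_; _<_; s≤s; _!; _≤?_)
import Data.Nat.Combinatorics as ℕC
import Data.Nat.DivMod as ℕ
import Data.Nat.Properties as ℕ
import Data.Integer as ℤ
import Data.Integer.Properties as ℤ
open import Data.Product using (_,_)
open import Data.Rational using (0ℚ; 1ℚ; _+_; -_; toℚᵘ)
open import Data.Rational.Properties as ℚ using (toℚᵘ-injective; toℚᵘ-fromℚᵘ; toℚᵘ-homo-+; toℚᵘ-homo-*)
open import Data.Rational.Solver using (module +-*-Solver)
open import Data.Rational.Unnormalised as ℚᵘ using (mkℚᵘ; *≡*; _≃_)
import Data.Rational.Unnormalised.Properties as ℚᵘ
open import Relation.Binary.PropositionalEquality using (refl; sym; trans; cong; cong₂; module ≡-Reasoning)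
open import Relation.Nullary using (yes; no)

open +-*-Solver
open GroupProperties ℚ.+-0-group using () renaming (∙-cancelʳ to +-cancelʳ)

[m+o]∸[n+o]≡m∸n : ∀ m n o → (m ℕ.+ o) ∸ (n ℕ.+ o) ≡ m ∸ n
[m+o]∸[n+o]≡m∸n m n o rewrite ℕ.+-comm m o | ℕ.+-comm n o = ℕ.[m+n]∸[m+o]≡n∸o o m n

toℚᵘ-ℕ/suc : ∀ a b → toℚᵘ ((+ a) / suc b) ≃ mkℚᵘ (+ a) b
toℚᵘ-ℕ/suc a b = toℚᵘ-fromℚᵘ (mkℚᵘ (+ a) b)

ℕ→ℚ-+ : ∀ a b → ℕ→ℚ (a ℕ.+ b) ≡ ℕ→ℚ a + ℕ→ℚ b
ℕ→ℚ-+ a b = toℚᵘ-injective (begin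
  toℚᵘ (ℕ→ℚ (a ℕ.+ b))                 ≈⟨ toℚᵘ-ℕ/suc (a ℕ.+ b) 0 ⟩
  mkℚᵘ (+ (a ℕ.+ b)) 0                  ≈⟨ *≡* numerators ⟩
  mkℚᵘ (+ a) 0 ℚᵘ.+ mkℚᵘ (+ b) 0        ≈⟨ ℚᵘ.+-cong (toℚᵘ-ℕ/suc a 0) (toℚᵘ-ℕ/suc b 0) ⟨
  toℚᵘ (ℕ→ℚ a) ℚᵘ.+ toℚᵘ (ℕ→ℚ b)        ≈⟨ toℚᵘ-homo-+ (ℕ→ℚ a) (ℕ→ℚ b) ⟨
  toℚᵘ (ℕ→ℚ a + ℕ→ℚ b)                  ∎)
  where
  open ℚᵘ.≃-Reasoning
  numerators : + (a ℕ.+ b) ℤ.* + 1 ≡ (+ a ℤ.* + 1 ℤ.+ + b ℤ.* + 1) ℤ.* + 1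
  numerators rewrite ℤ.*-identityʳ (+ a) | ℤ.*-identityʳ (+ b) = cong (ℤ._* + 1) (ℤ.pos-+ a b)

ℕ→ℚ-* : ∀ a b → ℕ→ℚ (a ℕ.* b) ≡ ℕ→ℚ a * ℕ→ℚ b
ℕ→ℚ-* a b = toℚᵘ-injective (begin
  toℚᵘ (ℕ→ℚ (a ℕ.* b))                 ≈⟨ toℚᵘ-ℕ/suc (a ℕ.* b) 0 ⟩
  mkℚᵘ (+ (a ℕ.* b)) 0                  ≈⟨ *≡* (cong (ℤ._* + 1) (ℤ.pos-* a b)) ⟩
  mkℚᵘ (+ a) 0 ℚᵘ.* mkℚᵘ (+ b) 0        ≈⟨ ℚᵘ.*-cong (toℚᵘ-ℕ/suc a 0) (toℚᵘ-ℕ/suc b 0) ⟨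
  toℚᵘ (ℕ→ℚ a) ℚᵘ.* toℚᵘ (ℕ→ℚ b)        ≈⟨ toℚᵘ-homo-* (ℕ→ℚ a) (ℕ→ℚ b) ⟨
  toℚᵘ (ℕ→ℚ a * ℕ→ℚ b)                  ∎)
  where open ℚᵘ.≃-Reasoning

/-*-cancel : ∀ a b .{{_ : NonZero b}} → ((+ a) / b) * ℕ→ℚ b ≡ ℕ→ℚ a
/-*-cancel a b@(suc b-1) = toℚᵘ-injective (begin
  toℚᵘ ((+ a) / b * ℕ→ℚ b)             ≈⟨ toℚᵘ-homo-* ((+ a) / b) (ℕ→ℚ b) ⟩
  toℚᵘ ((+ a) / b) ℚᵘ.* toℚᵘ (ℕ→ℚ b)    ≈⟨ ℚᵘ.*-cong (toℚᵘ-ℕ/suc a b-1) (toℚᵘ-ℕ/suc b 0) ⟩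
  mkℚᵘ (+ a) b-1 ℚᵘ.* mkℚᵘ (+ b) 0      ≈⟨ *≡* numerators ⟩
  mkℚᵘ (+ a) 0                          ≈⟨ toℚᵘ-ℕ/suc a 0 ⟨
  toℚᵘ (ℕ→ℚ a)                          ∎)
  where
  open ℚᵘ.≃-Reasoning
  numerators : (+ a ℤ.* + b) ℤ.* + 1 ≡ + a ℤ.* + (b ℕ.* 1)
  numerators rewrite ℤ.*-identityʳ (+ a ℤ.* + b) | ℕ.*-identityʳ b = refl

*-cancelʳ-ℕ→ℚ : ∀ x y c .{{_ : NonZero c}} → x * ℕ→ℚ c ≡ y * ℕ→ℚ c → x ≡ y
*-cancelʳ-ℕ→ℚ x y c xc≡yc = trans (sym (divide x)) (trans (cong (_* c⁻¹) xc≡yc) (divide y))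
  where
  c⁻¹ = (+ 1) / c
  divide : ∀ z → z * ℕ→ℚ c * c⁻¹ ≡ z
  divide z = begin
    z * ℕ→ℚ c * c⁻¹    ≡⟨ ℚ.*-assoc z (ℕ→ℚ c) c⁻¹ ⟩
    z * (ℕ→ℚ c * c⁻¹)  ≡⟨ cong (z *_) (trans (ℚ.*-comm (ℕ→ℚ c) c⁻¹) (/-*-cancel 1 c)) ⟩
    z * 1ℚ             ≡⟨ ℚ.*-identityʳ z ⟩
    z                  ∎
    where open ≡-Reasoning

/-cong : ∀ {a a′ b b′} .{{_ : NonZero b}} .{{_ : NonZero b′}} → a ≡ a′ → b ≡ b′ → (+ a) / b ≡ (+ a′) / b′
/-cong refl refl = refl

module Power {c ℓ} (M : CommutativeMonoid c ℓ) where
  open CommutativeMonoid M using (Carrier; _≈_; _∙_; ε; setoid; assoc; identityˡ; identityʳ; ∙-congˡ; ∙-congʳ)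
  open MonoidPower M using (×-homo-+; ×-distrib-+; ×-congʳ) renaming (_×_ to _times_)
  open SetoidReasoning setoid

  infixr 8 _^_
  _^_ : Carrier → ℕ → Carrier
  x ^ r = r times x

  ε^r≈ε : ∀ r → ε ^ r ≈ ε
  ε^r≈ε zero    = begin ε ∎
  ε^r≈ε (suc r) = begin ε ∙ ε ^ r ≈⟨ identityˡ (ε ^ r) ⟩ ε ^ r ≈⟨ ε^r≈ε r ⟩ ε ∎

  ^-inverse-cancel : ∀ {x y} → x ∙ y ≈ ε → ∀ j r → x ^ (j ℕ.+ r) ∙ y ^ r ≈ x ^ j
  ^-inverse-cancel {x} {y} xy≈ε j r = begin
    x ^ (j ℕ.+ r) ∙ y ^ r      ≈⟨ ∙-congʳ (×-homo-+ x j r) ⟩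
    (x ^ j ∙ x ^ r) ∙ y ^ r    ≈⟨ assoc (x ^ j) (x ^ r) (y ^ r) ⟩
    x ^ j ∙ (x ^ r ∙ y ^ r)    ≈⟨ ∙-congˡ (×-distrib-+ x y r) ⟨
    x ^ j ∙ (x ∙ y) ^ r        ≈⟨ ∙-congˡ (×-congʳ r xy≈ε) ⟩
    x ^ j ∙ ε ^ r              ≈⟨ ∙-congˡ (ε^r≈ε r) ⟩
    x ^ j ∙ ε                  ≈⟨ identityʳ (x ^ j) ⟩
    x ^ j                      ∎

-- Finite sums

∑ : ℕ → (ℕ → ℚ) → ℚ
∑ zero    f = 0ℚ
∑ (suc m) f = ∑ m f + f m

syntax ∑ m (λ i → e) = ∑[ i < m ] e

∑-unique : ∀ {f} (g : ℕ → ℚ) → g 0 ≡ 0ℚ → (∀ m → g (suc m) ≡ g m + f m) → ∀ m → g m ≡ ∑ m f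
∑-unique g g0 g-suc zero    = g0
∑-unique g g0 g-suc (suc m) = trans (g-suc m) (cong (_+ _) (∑-unique g g0 g-suc m))

-- The local summation function of sumFromTo cannot be named; abstracting
-- over its argument lets unification recover it from its defining equations.
sumFromTo≡∑ : ∀ j n f → sumFromTo j n f ≡ ∑[ i < suc n ∸ j ] f (j ℕ.+ i)
sumFromTo≡∑ j n f with ∑-unique _ refl (λ _ → refl) | suc n ∸ j
... | go≡∑ | m = go≡∑ m

∑-cong : ∀ m {f g} → (∀ i → i < m → f i ≡ g i) → ∑ m f ≡ ∑ m g
∑-cong zero    f≗g = refl
∑-cong (suc m) f≗g = cong₂ _+_ (∑-cong m (λ i i<m → f≗g i (ℕ.m<n⇒m<1+n i<m))) (f≗g m ℕ.≤-refl)

∑-zero : ∀ m {f} → (∀ i → i < m → f i ≡ 0ℚ) → ∑ m f ≡ 0ℚ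
∑-zero zero    f≗0 = refl
∑-zero (suc m) f≗0 = cong₂ _+_ (∑-zero m (λ i i<m → f≗0 i (ℕ.m<n⇒m<1+n i<m))) (f≗0 m ℕ.≤-refl)

∑-+ : ∀ m f g → ∑[ i < m ] (f i + g i) ≡ ∑ m f + ∑ m g
∑-+ zero    f g = refl
∑-+ (suc m) f g = begin
  ∑[ i < m ] (f i + g i) + (f m + g m)  ≡⟨ cong (_+ (f m + g m)) (∑-+ m f g) ⟩
  (∑ m f + ∑ m g) + (f m + g m)         ≡⟨ solve 4 (λ a b c d → (a :+ b) :+ (c :+ d) := (a :+ c) :+ (b :+ d))
                                                   refl (∑ m f) (∑ m g) (f m) (g m) ⟩
  (∑ m f + f m) + (∑ m g + g m)         ∎
  where open ≡-Reasoning

∑-*ˡ : ∀ m c f → ∑[ i < m ] (c * f i) ≡ c * ∑ m f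
∑-*ˡ zero    c f = sym (ℚ.*-zeroʳ c)
∑-*ˡ (suc m) c f = trans (cong (_+ c * f m) (∑-*ˡ m c f)) (sym (ℚ.*-distribˡ-+ c (∑ m f) (f m)))

∑-*ʳ : ∀ m c f → ∑[ i < m ] (f i * c) ≡ ∑ m f * c
∑-*ʳ m c f = begin
  ∑[ i < m ] (f i * c)  ≡⟨ ∑-cong m (λ i _ → ℚ.*-comm (f i) c) ⟩
  ∑[ i < m ] (c * f i)  ≡⟨ ∑-*ˡ m c f ⟩
  c * ∑ m f             ≡⟨ ℚ.*-comm c (∑ m f) ⟩
  ∑ m f * c             ∎
  where open ≡-Reasoning

∑-suc : ∀ m f → ∑ (suc m) f ≡ f 0 + ∑[ i < m ] f (suc i)
∑-suc zero    f = trans (ℚ.+-identityˡ (f 0)) (sym (ℚ.+-identityʳ (f 0)))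
∑-suc (suc m) f = trans (cong (_+ f (suc m)) (∑-suc m f)) (ℚ.+-assoc (f 0) _ _)

∑-split : ∀ a b f → ∑ (a ℕ.+ b) f ≡ ∑ a f + ∑[ i < b ] f (a ℕ.+ i)
∑-split a zero    f = trans (cong (λ m → ∑ m f) (ℕ.+-identityʳ a)) (sym (ℚ.+-identityʳ (∑ a f)))
∑-split a (suc b) f = begin
  ∑ (a ℕ.+ suc b) f                                  ≡⟨ cong (λ m → ∑ m f) (ℕ.+-suc a b) ⟩
  ∑ (a ℕ.+ b) f + f (a ℕ.+ b)                        ≡⟨ cong (_+ f (a ℕ.+ b)) (∑-split a b f) ⟩
  (∑ a f + ∑[ i < b ] f (a ℕ.+ i)) + f (a ℕ.+ b)     ≡⟨ ℚ.+-assoc (∑ a f) _ _ ⟩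
  ∑ a f + (∑[ i < b ] f (a ℕ.+ i) + f (a ℕ.+ b))     ∎
  where open ≡-Reasoning

∑-reverse : ∀ m f → ∑ m f ≡ ∑[ i < m ] f (m ∸ suc i)
∑-reverse zero    f = refl
∑-reverse (suc m) f = begin
  ∑ m f + f m                              ≡⟨ cong (_+ f m) (∑-reverse m f) ⟩
  ∑[ i < m ] f (m ∸ suc i) + f m           ≡⟨ ℚ.+-comm _ (f m) ⟩
  f m + ∑[ i < m ] f (m ∸ suc i)           ≡⟨ ∑-suc m (λ i → f (suc m ∸ suc i)) ⟨
  ∑[ i < suc m ] f (suc m ∸ suc i)         ∎
  where open ≡-Reasoning

∑-swap : ∀ m p (h : ℕ → ℕ → ℚ) → ∑[ i < m ] ∑ p (h i) ≡ ∑[ k < p ] ∑[ i < m ] h i k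
∑-swap zero    p h = sym (∑-zero p (λ _ _ → refl))
∑-swap (suc m) p h = begin
  ∑[ i < m ] ∑ p (h i) + ∑ p (h m)          ≡⟨ cong (_+ ∑ p (h m)) (∑-swap m p h) ⟩
  ∑[ k < p ] ∑[ i < m ] h i k + ∑ p (h m)   ≡⟨ ∑-+ p _ (h m) ⟨
  ∑[ k < p ] (∑[ i < m ] h i k + h m k)     ∎
  where open ≡-Reasoning

sumFromTo-cong : ∀ j n {f g} → (∀ k → f k ≡ g k) → sumFromTo j n f ≡ sumFromTo j n g
sumFromTo-cong j n {f} {g} f≗g = begin
  sumFromTo j n f                      ≡⟨ sumFromTo≡∑ j n f ⟩
  ∑[ i < suc n ∸ j ] f (j ℕ.+ i)       ≡⟨ ∑-cong (suc n ∸ j) (λ i _ → f≗g (j ℕ.+ i)) ⟩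
  ∑[ i < suc n ∸ j ] g (j ℕ.+ i)       ≡⟨ sumFromTo≡∑ j n g ⟨
  sumFromTo j n g                      ∎
  where open ≡-Reasoning

-- Multiplication by t^k.
shiftBy : ℕ → Series → Series
shiftBy zero    a n       = a n
shiftBy (suc k) a zero    = 0ℚ
shiftBy (suc k) a (suc n) = shiftBy k a n

shiftBy-≥ : ∀ k a {n} → k ≤ n → shiftBy k a n ≡ a (n ∸ k)
shiftBy-≥ zero    a k≤n       = refl
shiftBy-≥ (suc k) a (s≤s k≤n) = shiftBy-≥ k a k≤n

shiftBy-< : ∀ k a {n} → n < k → shiftBy k a n ≡ 0ℚ
shiftBy-< (suc k) a {zero}  _         = refl
shiftBy-< (suc k) a {suc n} (s≤s n<k) = shiftBy-< k a n<k

∑-shiftBy : ∀ k m a → ∑ m (shiftBy k a) ≡ ∑ (m ∸ k) a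
∑-shiftBy zero    m       a = refl
∑-shiftBy (suc k) zero    a = refl
∑-shiftBy (suc k) (suc m) a = trans (∑-suc m (shiftBy (suc k) a)) (trans (ℚ.+-identityˡ _) (∑-shiftBy k m a))

∑-antidiagonal : ∀ m {s} (h : ℕ → ℕ → ℚ) → s < m →
                 ∑[ i < m ] shiftBy i (h i) s ≡ ∑[ i < suc s ] h i (s ∸ i)
∑-antidiagonal m {s} h s<m = begin
  ∑ m H                                                  ≡⟨ cong (λ m → ∑ m H) (ℕ.m+[n∸m]≡n s<m) ⟨
  ∑ (suc s ℕ.+ (m ∸ suc s)) H                            ≡⟨ ∑-split (suc s) (m ∸ suc s) H ⟩
  ∑ (suc s) H + ∑[ i < m ∸ suc s ] H (suc s ℕ.+ i)       ≡⟨ cong₂ _+_ (∑-cong (suc s) diagonal) (∑-zero (m ∸ suc s) beyond) ⟩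
  ∑[ i < suc s ] h i (s ∸ i) + 0ℚ                         ≡⟨ ℚ.+-identityʳ _ ⟩
  ∑[ i < suc s ] h i (s ∸ i)                              ∎
  where
  open ≡-Reasoning
  H : ℕ → ℚ
  H i = shiftBy i (h i) s
  diagonal : ∀ i → i < suc s → H i ≡ h i (s ∸ i)
  diagonal i i<1+s = shiftBy-≥ i (h i) (ℕ.≤-pred i<1+s)
  beyond : ∀ i → i < m ∸ suc s → H (suc s ℕ.+ i) ≡ 0ℚ
  beyond i _ = shiftBy-< (suc s ℕ.+ i) (h (suc s ℕ.+ i)) (s≤s (ℕ.m≤m+n s i))

∑-triangle : ∀ m (h : ℕ → ℕ → ℚ) →
             ∑[ i < m ] ∑ (m ∸ i) (h i) ≡ ∑[ s < m ] ∑[ i < suc s ] h i (s ∸ i)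
∑-triangle m h = begin
  ∑[ i < m ] ∑ (m ∸ i) (h i)                    ≡⟨ ∑-cong m (λ i _ → ∑-shiftBy i m (h i)) ⟨
  ∑[ i < m ] ∑[ s < m ] shiftBy i (h i) s       ≡⟨ ∑-swap m m (λ i → shiftBy i (h i)) ⟩
  ∑[ s < m ] ∑[ i < m ] shiftBy i (h i) s       ≡⟨ ∑-cong m (λ s → ∑-antidiagonal m h) ⟩
  ∑[ s < m ] ∑[ i < suc s ] h i (s ∸ i)         ∎
  where open ≡-Reasoning

-- Power series

infix 4 _≐_
_≐_ : Series → Series → Set
a ≐ b = ∀ n → a n ≡ b n

⊛-def : ∀ a b n → (a ⊛ b) n ≡ ∑[ i < suc n ] (a i * b (n ∸ i))
⊛-def a b n = sumFromTo≡∑ 0 n (λ i → a i * b (n ∸ i))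

⊛-cong : ∀ {a a′ b b′} → a ≐ a′ → b ≐ b′ → a ⊛ b ≐ a′ ⊛ b′
⊛-cong {a} {a′} {b} {b′} a≐a′ b≐b′ n = begin
  (a ⊛ b) n                            ≡⟨ ⊛-def a b n ⟩
  ∑[ i < suc n ] (a i * b (n ∸ i))     ≡⟨ ∑-cong (suc n) (λ i _ → cong₂ _*_ (a≐a′ i) (b≐b′ (n ∸ i))) ⟩
  ∑[ i < suc n ] (a′ i * b′ (n ∸ i))   ≡⟨ ⊛-def a′ b′ n ⟨
  (a′ ⊛ b′) n                          ∎
  where open ≡-Reasoning

⊛-comm : ∀ a b → a ⊛ b ≐ b ⊛ a
⊛-comm a b n = begin
  (a ⊛ b) n                                        ≡⟨ ⊛-def a b n ⟩
  ∑[ i < suc n ] (a i * b (n ∸ i))                 ≡⟨ ∑-reverse (suc n) _ ⟩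
  ∑[ i < suc n ] (a (n ∸ i) * b (n ∸ (n ∸ i)))     ≡⟨ ∑-cong (suc n) reflect ⟩
  ∑[ i < suc n ] (b i * a (n ∸ i))                 ≡⟨ ⊛-def b a n ⟨
  (b ⊛ a) n                                        ∎
  where
  open ≡-Reasoning
  reflect : ∀ i → i < suc n → a (n ∸ i) * b (n ∸ (n ∸ i)) ≡ b i * a (n ∸ i)
  reflect i i<1+n = trans (cong (λ k → a (n ∸ i) * b k) (ℕ.m∸[m∸n]≡n (ℕ.≤-pred i<1+n)))
                          (ℚ.*-comm (a (n ∸ i)) (b i))

⊛-assoc : ∀ a b c → (a ⊛ b) ⊛ c ≐ a ⊛ (b ⊛ c)
⊛-assoc a b c n = begin
  ((a ⊛ b) ⊛ c) n                                          ≡⟨ ⊛-def (a ⊛ b) c n ⟩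
  ∑[ s < suc n ] ((a ⊛ b) s * c (n ∸ s))                   ≡⟨ ∑-cong (suc n) expandˡ ⟩
  ∑[ s < suc n ] ∑[ i < suc s ] h i (s ∸ i)                ≡⟨ ∑-triangle (suc n) h ⟨
  ∑[ i < suc n ] ∑ (suc n ∸ i) (h i)                       ≡⟨ ∑-cong (suc n) foldʳ ⟩
  ∑[ i < suc n ] (a i * (b ⊛ c) (n ∸ i))                   ≡⟨ ⊛-def a (b ⊛ c) n ⟨
  (a ⊛ (b ⊛ c)) n                                          ∎
  where
  open ≡-Reasoning
  h : ℕ → ℕ → ℚ
  h i k = a i * (b k * c (n ∸ i ∸ k))
  expandˡ : ∀ s → s < suc n → (a ⊛ b) s * c (n ∸ s) ≡ ∑[ i < suc s ] h i (s ∸ i)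
  expandˡ s s<1+n = begin
    (a ⊛ b) s * c (n ∸ s)                           ≡⟨ cong (_* c (n ∸ s)) (⊛-def a b s) ⟩
    ∑[ i < suc s ] (a i * b (s ∸ i)) * c (n ∸ s)    ≡⟨ ∑-*ʳ (suc s) (c (n ∸ s)) _ ⟨
    ∑[ i < suc s ] (a i * b (s ∸ i) * c (n ∸ s))    ≡⟨ ∑-cong (suc s) reassociate ⟩
    ∑[ i < suc s ] h i (s ∸ i)                      ∎
    where
    reassociate : ∀ i → i < suc s → a i * b (s ∸ i) * c (n ∸ s) ≡ h i (s ∸ i)
    reassociate i i<1+s = trans (ℚ.*-assoc (a i) (b (s ∸ i)) (c (n ∸ s)))
      (cong (λ k → a i * (b (s ∸ i) * c k))
            (trans (cong (n ∸_) (sym (ℕ.m+[n∸m]≡n (ℕ.≤-pred i<1+s)))) (sym (ℕ.∸-+-assoc n i (s ∸ i)))))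
  foldʳ : ∀ i → i < suc n → ∑ (suc n ∸ i) (h i) ≡ a i * (b ⊛ c) (n ∸ i)
  foldʳ i i<1+n = begin
    ∑ (suc n ∸ i) (h i)                                     ≡⟨ cong (λ m → ∑ m (h i)) (ℕ.+-∸-assoc 1 (ℕ.≤-pred i<1+n)) ⟩
    ∑[ k < suc (n ∸ i) ] (a i * (b k * c (n ∸ i ∸ k)))      ≡⟨ ∑-*ˡ (suc (n ∸ i)) (a i) _ ⟩
    a i * ∑[ k < suc (n ∸ i) ] (b k * c (n ∸ i ∸ k))        ≡⟨ cong (a i *_) (⊛-def b c (n ∸ i)) ⟨
    a i * (b ⊛ c) (n ∸ i)                                   ∎

⊛-identityˡ : ∀ a → oneS ⊛ a ≐ a
⊛-identityˡ a n = begin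
  (oneS ⊛ a) n                                        ≡⟨ ⊛-def oneS a n ⟩
  ∑[ i < suc n ] (oneS i * a (n ∸ i))                 ≡⟨ ∑-suc n _ ⟩
  1ℚ * a n + ∑[ i < n ] (0ℚ * a (n ∸ suc i))          ≡⟨ cong₂ _+_ (ℚ.*-identityˡ (a n)) (∑-zero n (λ i _ → ℚ.*-zeroˡ (a (n ∸ suc i)))) ⟩
  a n + 0ℚ                                            ≡⟨ ℚ.+-identityʳ (a n) ⟩
  a n                                                 ∎
  where open ≡-Reasoning

⊛-commutativeMonoid : CommutativeMonoid _ _
⊛-commutativeMonoid = record
  { Carrier = Series
  ; _≈_     = _≐_
  ; _∙_     = _⊛_
  ; ε       = oneS
  ; isCommutativeMonoid = record
    { isMonoid = record
      { isSemigroup = record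
        { isMagma = record
          { isEquivalence = record
            { refl  = λ _ → refl
            ; sym   = λ a≐b n → sym (a≐b n)
            ; trans = λ a≐b b≐c n → trans (a≐b n) (b≐c n)
            }
          ; ∙-cong = ⊛-cong
          }
        ; assoc = ⊛-assoc
        }
      ; identity = ⊛-identityˡ , λ a n → trans (⊛-comm a oneS n) (⊛-identityˡ a n)
      }
    ; comm = ⊛-comm
    }
  }

open Power ⊛-commutativeMonoid using () renaming (_^_ to _^⊛_; ^-inverse-cancel to ^⊛-inverse-cancel)

^S≡^⊛ : ∀ a r → a ^S r ≡ a ^⊛ r
^S≡^⊛ a zero    = refl
^S≡^⊛ a (suc r) = cong (a ⊛_) (^S≡^⊛ a r)

^S-inverse-cancel : ∀ {a b} → a ⊛ b ≐ oneS → ∀ j r → (a ^S (j ℕ.+ r)) ⊛ (b ^S r) ≐ a ^S j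
^S-inverse-cancel {a} {b} ab≐1 j r
  rewrite ^S≡^⊛ a (j ℕ.+ r) | ^S≡^⊛ b r | ^S≡^⊛ a j = ^⊛-inverse-cancel ab≐1 j r

-- The function `weighted` of Defs, which is private there; invS-suc identifies
-- the two by unification once their arguments have been abstracted.
weightedSum : Series → ℕ → List ℚ → ℚ
weightedSum a m []       = 0ℚ
weightedSum a m (x ∷ xs) = a (suc m) * x + weightedSum a (suc m) xs

weightedSum-unique : ∀ a (W : ℕ → List ℚ → ℚ) → (∀ m → W m [] ≡ 0ℚ) →
                     (∀ m x xs → W m (x ∷ xs) ≡ a (suc m) * x + W (suc m) xs) →
                     ∀ m xs → W m xs ≡ weightedSum a m xs
weightedSum-unique a W W-[] W-∷ m []       = W-[] m
weightedSum-unique a W W-[] W-∷ m (x ∷ xs) =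
  trans (W-∷ m x xs) (cong (_+_ (a (suc m) * x)) (weightedSum-unique a W W-[] W-∷ (suc m) xs))

invS-suc : ∀ a n → invS a (suc n) ≡ - weightedSum a 0 (invPrefix a n)
invS-suc a n with weightedSum-unique a _ (λ _ → refl) (λ _ _ _ → refl) | zero | invPrefix a n
... | W≡weightedSum | m | xs = cong -_ (W≡weightedSum m xs)

weightedSum-invPrefix : ∀ a m n → weightedSum a m (invPrefix a n) ≡ ∑[ i < suc n ] (a (suc m ℕ.+ i) * invS a (n ∸ i))
weightedSum-invPrefix a m zero = begin
  a (suc m) * 1ℚ + 0ℚ          ≡⟨ ℚ.+-identityʳ _ ⟩
  a (suc m) * 1ℚ               ≡⟨ cong (λ k → a k * 1ℚ) (ℕ.+-identityʳ (suc m)) ⟨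
  a (suc m ℕ.+ 0) * 1ℚ         ≡⟨ ℚ.+-identityˡ _ ⟨
  0ℚ + a (suc m ℕ.+ 0) * 1ℚ    ∎
  where open ≡-Reasoning
weightedSum-invPrefix a m (suc n) = begin
  a (suc m) * invS a (suc n) + weightedSum a (suc m) (invPrefix a n)
    ≡⟨ cong (_+_ (a (suc m) * invS a (suc n))) (weightedSum-invPrefix a (suc m) n) ⟩
  a (suc m) * invS a (suc n) + ∑[ i < suc n ] (a (suc (suc m) ℕ.+ i) * invS a (n ∸ i))
    ≡⟨ cong₂ _+_ (cong (λ k → a k * invS a (suc n)) (sym (ℕ.+-identityʳ (suc m))))
                 (∑-cong (suc n) (λ i _ → cong (λ k → a k * invS a (n ∸ i)) (sym (ℕ.+-suc (suc m) i)))) ⟩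
  a (suc m ℕ.+ 0) * invS a (suc n) + ∑[ i < suc n ] (a (suc m ℕ.+ suc i) * invS a (n ∸ i))
    ≡⟨ ∑-suc (suc n) _ ⟨
  ∑[ i < suc (suc n) ] (a (suc m ℕ.+ i) * invS a (suc n ∸ i))
    ∎
  where open ≡-Reasoning

⊛-invS : ∀ a → a 0 ≡ 1ℚ → a ⊛ invS a ≐ oneS
⊛-invS a a₀≡1 zero = begin
  (a ⊛ invS a) 0    ≡⟨ ⊛-def a (invS a) 0 ⟩
  0ℚ + a 0 * 1ℚ     ≡⟨ cong (λ x → 0ℚ + x * 1ℚ) a₀≡1 ⟩
  1ℚ                ∎
  where open ≡-Reasoning
⊛-invS a a₀≡1 (suc n) = begin
  (a ⊛ invS a) (suc n)                                      ≡⟨ ⊛-def a (invS a) (suc n) ⟩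
  ∑[ i < suc (suc n) ] (a i * invS a (suc n ∸ i))           ≡⟨ ∑-suc (suc n) _ ⟩
  a 0 * invS a (suc n) + tail                               ≡⟨ cong₂ (λ x y → x * y + tail) a₀≡1 (invS-suc a n) ⟩
  1ℚ * (- weightedSum a 0 (invPrefix a n)) + tail           ≡⟨ cong (λ x → 1ℚ * (- x) + tail) (weightedSum-invPrefix a 0 n) ⟩
  1ℚ * (- tail) + tail                                      ≡⟨ solve 1 (λ t → con 1ℚ :* (:- t) :+ t := con 0ℚ) refl tail ⟩
  0ℚ                                                        ∎
  where
  open ≡-Reasoning
  tail = ∑[ i < suc n ] (a (suc i) * invS a (n ∸ i))

-- Binomial coefficients and Stirling numbers

Cℚ : ℕ → ℕ → ℚ
Cℚ n k = ℕ→ℚ (n C k)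

Sℚ : ℕ → ℕ → ℚ
Sℚ n k = ℕ→ℚ (stirling2 n k)

Cℚ-pascal : ∀ n k → Cℚ (suc n) (suc k) ≡ Cℚ n k + Cℚ n (suc k)
Cℚ-pascal n k = trans (cong ℕ→ℚ (sym (ℕC.nCk+nC[k+1]≡[n+1]C[k+1] n k))) (ℕ→ℚ-+ (n C k) (n C suc k))

Sℚ-suc : ∀ n k → Sℚ (suc n) (suc k) ≡ ℕ→ℚ (suc k) * Sℚ n (suc k) + Sℚ n k
Sℚ-suc n k = trans (ℕ→ℚ-+ (suc k ℕ.* stirling2 n (suc k)) (stirling2 n k))
                   (cong (_+ Sℚ n k) (ℕ→ℚ-* (suc k) (stirling2 n (suc k))))

stirling2-< : ∀ {n k} → n < k → stirling2 n k ≡ 0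
stirling2-< {zero}  {suc k} _         = refl
stirling2-< {suc n} {suc k} (s≤s n<k)
  rewrite stirling2-< {n} {suc k} (ℕ.m<n⇒m<1+n n<k) | stirling2-< n<k = trans (ℕ.+-identityʳ _) (ℕ.*-zeroʳ (suc k))

binomial-factorials : ∀ {n i} → i ≤ n → Cℚ n i * (ℕ→ℚ (i !) * ℕ→ℚ ((n ∸ i) !)) ≡ ℕ→ℚ (n !)
binomial-factorials {n} {i} i≤n = begin
  Cℚ n i * (ℕ→ℚ (i !) * ℕ→ℚ ((n ∸ i) !))   ≡⟨ cong (Cℚ n i *_) (ℕ→ℚ-* (i !) ((n ∸ i) !)) ⟨
  Cℚ n i * ℕ→ℚ (i ! ℕ.* (n ∸ i) !)          ≡⟨ ℕ→ℚ-* (n C i) (i ! ℕ.* (n ∸ i) !) ⟨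
  ℕ→ℚ ((n C i) ℕ.* (i ! ℕ.* (n ∸ i) !))     ≡⟨ cong ℕ→ℚ (cong (ℕ._* (i ! ℕ.* (n ∸ i) !)) (ℕC.nCk≡n!/k![n-k]! i≤n)) ⟩
  ℕ→ℚ (n ! ℕ./ (i ! ℕ.* (n ∸ i) !) ℕ.* (i ! ℕ.* (n ∸ i) !))   ≡⟨ cong ℕ→ℚ (ℕ.m/n*n≡m (ℕC.k![n∸k]!∣n! i≤n)) ⟩
  ℕ→ℚ (n !)                                  ∎
  where
  open ≡-Reasoning
  instance _ = ℕ._!*_!≢0 i (n ∸ i)

binomial-factorials-+ : ∀ m r → Cℚ (m ℕ.+ r) r * (ℕ→ℚ (r !) * ℕ→ℚ (m !)) ≡ ℕ→ℚ ((m ℕ.+ r) !)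
binomial-factorials-+ m r = begin
  Cℚ (m ℕ.+ r) r * (ℕ→ℚ (r !) * ℕ→ℚ (m !))                ≡⟨ cong (λ k → Cℚ (m ℕ.+ r) r * (ℕ→ℚ (r !) * ℕ→ℚ (k !))) (ℕ.m+n∸n≡m m r) ⟨
  Cℚ (m ℕ.+ r) r * (ℕ→ℚ (r !) * ℕ→ℚ ((m ℕ.+ r ∸ r) !))    ≡⟨ binomial-factorials (ℕ.m≤n+m r m) ⟩
  ℕ→ℚ ((m ℕ.+ r) !)                                       ∎
  where open ≡-Reasoning

binomialSum : ℕ → (ℕ → ℚ) → ℚ
binomialSum n f = ∑[ k < suc n ] (Cℚ n k * f k)

binomialSum-linear : ∀ n c f g → binomialSum n (λ k → c * f k + g k) ≡ c * binomialSum n f + binomialSum n g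
binomialSum-linear n c f g = begin
  ∑[ k < suc n ] (Cℚ n k * (c * f k + g k))              ≡⟨ ∑-cong (suc n) (λ k _ → distribute (Cℚ n k) (f k) (g k)) ⟩
  ∑[ k < suc n ] (c * (Cℚ n k * f k) + Cℚ n k * g k)     ≡⟨ ∑-+ (suc n) _ _ ⟩
  ∑[ k < suc n ] (c * (Cℚ n k * f k)) + binomialSum n g  ≡⟨ cong (_+ binomialSum n g) (∑-*ˡ (suc n) c _) ⟩
  c * binomialSum n f + binomialSum n g                  ∎
  where
  open ≡-Reasoning
  distribute : ∀ b x y → b * (c * x + y) ≡ c * (b * x) + b * y
  distribute = solve 4 (λ c b x y → b :* (c :* x :+ y) := c :* (b :* x) :+ b :* y) refl c

binomialSum-suc : ∀ n f → binomialSum (suc n) f ≡ binomialSum n f + binomialSum n (λ k → f (suc k))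
binomialSum-suc n f = begin
  ∑[ k < suc (suc n) ] (Cℚ (suc n) k * f k)                                    ≡⟨ ∑-suc (suc n) _ ⟩
  f₀ + ∑[ k < suc n ] (Cℚ (suc n) (suc k) * f (suc k))                         ≡⟨ cong (_+_ f₀) (∑-cong (suc n) pascal) ⟩
  f₀ + ∑[ k < suc n ] (Cℚ n k * f (suc k) + Cℚ n (suc k) * f (suc k))          ≡⟨ cong (_+_ f₀) (∑-+ (suc n) _ _) ⟩
  f₀ + (binomialSum n (λ k → f (suc k)) + upper)                                ≡⟨ solve 3 (λ a b c → a :+ (b :+ c) := (a :+ c) :+ b) refl f₀ _ upper ⟩
  (f₀ + upper) + binomialSum n (λ k → f (suc k))                                ≡⟨ cong (_+ binomialSum n (λ k → f (suc k))) lower ⟩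
  binomialSum n f + binomialSum n (λ k → f (suc k))                             ∎
  where
  open ≡-Reasoning
  f₀ = Cℚ n 0 * f 0
  upper = ∑[ k < suc n ] (Cℚ n (suc k) * f (suc k))
  pascal : ∀ k → k < suc n → Cℚ (suc n) (suc k) * f (suc k) ≡ Cℚ n k * f (suc k) + Cℚ n (suc k) * f (suc k)
  pascal k _ = trans (cong (_* f (suc k)) (Cℚ-pascal n k)) (ℚ.*-distribʳ-+ (f (suc k)) (Cℚ n k) (Cℚ n (suc k)))
  lower : f₀ + upper ≡ binomialSum n f
  lower = begin
    f₀ + upper                                  ≡⟨ ∑-suc (suc n) (λ k → Cℚ n k * f k) ⟨
    binomialSum n f + Cℚ n (suc n) * f (suc n)  ≡⟨ cong (λ c → binomialSum n f + c * f (suc n)) (cong ℕ→ℚ (ℕC.k>n⇒nCk≡0 (ℕ.n<1+n n))) ⟩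
    binomialSum n f + 0ℚ * f (suc n)            ≡⟨ cong (_+_ (binomialSum n f)) (ℚ.*-zeroˡ (f (suc n))) ⟩
    binomialSum n f + 0ℚ                        ≡⟨ ℚ.+-identityʳ (binomialSum n f) ⟩
    binomialSum n f                             ∎

Sℚ-binomialSum : ∀ n k → binomialSum n (λ l → Sℚ l k) ≡ Sℚ (suc n) (suc k)
Sℚ-binomialSum zero zero    = refl
Sℚ-binomialSum zero (suc k) = cong ℕ→ℚ (sym (trans (ℕ.+-identityʳ (suc (suc k) ℕ.* 0)) (ℕ.*-zeroʳ (suc (suc k)))))
Sℚ-binomialSum (suc n) k = begin
  binomialSum (suc n) (λ l → Sℚ l k)                                  ≡⟨ binomialSum-suc n _ ⟩
  binomialSum n (λ l → Sℚ l k) + binomialSum n (λ l → Sℚ (suc l) k)   ≡⟨ cong (_+ binomialSum n (λ l → Sℚ (suc l) k)) (Sℚ-binomialSum n k) ⟩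
  Sℚ (suc n) (suc k) + binomialSum n (λ l → Sℚ (suc l) k)             ≡⟨ shifted k ⟩
  Sℚ (suc (suc n)) (suc k)                                            ∎
  where
  open ≡-Reasoning
  shifted : ∀ k → Sℚ (suc n) (suc k) + binomialSum n (λ l → Sℚ (suc l) k) ≡ Sℚ (suc (suc n)) (suc k)
  shifted zero = begin
    Sℚ (suc n) 1 + binomialSum n (λ _ → 0ℚ)    ≡⟨ cong (_+_ (Sℚ (suc n) 1)) (∑-zero (suc n) (λ l _ → ℚ.*-zeroʳ (Cℚ n l))) ⟩
    Sℚ (suc n) 1 + 0ℚ                          ≡⟨ cong (_+ 0ℚ) (ℚ.*-identityˡ (Sℚ (suc n) 1)) ⟨
    1ℚ * Sℚ (suc n) 1 + 0ℚ                     ≡⟨ Sℚ-suc (suc n) 0 ⟨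
    Sℚ (suc (suc n)) 1                         ∎
  shifted (suc k) = begin
    Sℚ (suc n) (2+ k) + binomialSum n (λ l → Sℚ (suc l) (suc k))
      ≡⟨ cong (_+_ (Sℚ (suc n) (2+ k))) (∑-cong (suc n) (λ l _ → cong (Cℚ n l *_) (Sℚ-suc l k))) ⟩
    Sℚ (suc n) (2+ k) + binomialSum n (λ l → ℕ→ℚ (suc k) * Sℚ l (suc k) + Sℚ l k)
      ≡⟨ cong (_+_ (Sℚ (suc n) (2+ k))) (binomialSum-linear n (ℕ→ℚ (suc k)) _ _) ⟩
    Sℚ (suc n) (2+ k) + (ℕ→ℚ (suc k) * binomialSum n (λ l → Sℚ l (suc k)) + binomialSum n (λ l → Sℚ l k))
      ≡⟨ cong₂ (λ x y → Sℚ (suc n) (2+ k) + (ℕ→ℚ (suc k) * x + y)) (Sℚ-binomialSum n (suc k)) (Sℚ-binomialSum n k) ⟩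
    Sℚ (suc n) (2+ k) + (ℕ→ℚ (suc k) * Sℚ (suc n) (2+ k) + Sℚ (suc n) (suc k))
      ≡⟨ solve 3 (λ x c y → x :+ (c :* x :+ y) := (con 1ℚ :+ c) :* x :+ y) refl (Sℚ (suc n) (2+ k)) (ℕ→ℚ (suc k)) _ ⟩
    (1ℚ + ℕ→ℚ (suc k)) * Sℚ (suc n) (2+ k) + Sℚ (suc n) (suc k)
      ≡⟨ cong (λ c → c * Sℚ (suc n) (2+ k) + Sℚ (suc n) (suc k)) (ℕ→ℚ-+ 1 (suc k)) ⟨
    ℕ→ℚ (2+ k) * Sℚ (suc n) (2+ k) + Sℚ (suc n) (suc k)
      ≡⟨ Sℚ-suc (suc n) (suc k) ⟨
    Sℚ (suc (suc n)) (2+ k)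
      ∎

Sℚ-binomialSum-below : ∀ n k → ℕ→ℚ (suc k) * Sℚ n (suc k) ≡ ∑[ l < n ] (Cℚ n l * Sℚ l k)
Sℚ-binomialSum-below zero    k = ℚ.*-zeroʳ (ℕ→ℚ (suc k))
Sℚ-binomialSum-below (suc n) k = +-cancelʳ (Sℚ (suc n) k) _ _ (begin
  ℕ→ℚ (suc k) * Sℚ (suc n) (suc k) + Sℚ (suc n) k              ≡⟨ Sℚ-suc (suc n) k ⟨
  Sℚ (suc (suc n)) (suc k)                                     ≡⟨ Sℚ-binomialSum (suc n) k ⟨
  lower + Cℚ (suc n) (suc n) * Sℚ (suc n) k                    ≡⟨ cong (λ c → lower + ℕ→ℚ c * Sℚ (suc n) k) (ℕC.nCn≡1 (suc n)) ⟩
  lower + 1ℚ * Sℚ (suc n) k                                    ≡⟨ cong (_+_ lower) (ℚ.*-identityˡ (Sℚ (suc n) k)) ⟩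
  lower + Sℚ (suc n) k                                         ∎)
  where
  open ≡-Reasoning
  lower = ∑[ l < suc n ] (Cℚ (suc n) l * Sℚ l k)

-- Exponential generating functions

factorials-split : ∀ {n i} → i ≤ n → ∀ x y →
                   ℕ→ℚ (n !) * (x * y) ≡ Cℚ n i * (ℕ→ℚ (i !) * x) * (ℕ→ℚ ((n ∸ i) !) * y)
factorials-split {n} {i} i≤n x y = begin
  ℕ→ℚ (n !) * (x * y)                                          ≡⟨ cong (_* (x * y)) (binomial-factorials i≤n) ⟨
  Cℚ n i * (ℕ→ℚ (i !) * ℕ→ℚ ((n ∸ i) !)) * (x * y)              ≡⟨ solve 5 (λ c p q x y → c :* (p :* q) :* (x :* y) := c :* (p :* x) :* (q :* y))
                                                                          refl (Cℚ n i) (ℕ→ℚ (i !)) (ℕ→ℚ ((n ∸ i) !)) x y ⟩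
  Cℚ n i * (ℕ→ℚ (i !) * x) * (ℕ→ℚ ((n ∸ i) !) * y)             ∎
  where open ≡-Reasoning

factorial-⊛ : ∀ a b n → ℕ→ℚ (n !) * (a ⊛ b) n
              ≡ ∑[ i < suc n ] (Cℚ n i * (ℕ→ℚ (i !) * a i) * (ℕ→ℚ ((n ∸ i) !) * b (n ∸ i)))
factorial-⊛ a b n = begin
  ℕ→ℚ (n !) * (a ⊛ b) n                          ≡⟨ cong (ℕ→ℚ (n !) *_) (⊛-def a b n) ⟩
  ℕ→ℚ (n !) * ∑[ i < suc n ] (a i * b (n ∸ i))   ≡⟨ ∑-*ˡ (suc n) (ℕ→ℚ (n !)) _ ⟨
  ∑[ i < suc n ] (ℕ→ℚ (n !) * (a i * b (n ∸ i))) ≡⟨ ∑-cong (suc n) (λ i i<1+n → factorials-split (ℕ.≤-pred i<1+n) (a i) (b (n ∸ i))) ⟩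
  ∑[ i < suc n ] (Cℚ n i * (ℕ→ℚ (i !) * a i) * (ℕ→ℚ ((n ∸ i) !) * b (n ∸ i))) ∎
  where open ≡-Reasoning

shiftBy-cong : ∀ k {a b} → a ≐ b → shiftBy k a ≐ shiftBy k b
shiftBy-cong zero    a≐b n       = a≐b n
shiftBy-cong (suc k) a≐b zero    = refl
shiftBy-cong (suc k) a≐b (suc n) = shiftBy-cong k a≐b n

shiftBy-⊛ˡ : ∀ k a b → shiftBy k a ⊛ b ≐ shiftBy k (a ⊛ b)
shiftBy-⊛ˡ zero    a b n       = refl
shiftBy-⊛ˡ (suc k) a b zero    = trans (ℚ.+-identityˡ _) (ℚ.*-zeroˡ (b 0))
shiftBy-⊛ˡ (suc k) a b (suc n) = begin
  (shiftBy (suc k) a ⊛ b) (suc n)                                      ≡⟨ ⊛-def (shiftBy (suc k) a) b (suc n) ⟩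
  ∑[ i < suc (suc n) ] (shiftBy (suc k) a i * b (suc n ∸ i))           ≡⟨ ∑-suc (suc n) _ ⟩
  0ℚ * b (suc n) + ∑[ i < suc n ] (shiftBy k a i * b (n ∸ i))          ≡⟨ cong (_+ ∑[ i < suc n ] (shiftBy k a i * b (n ∸ i))) (ℚ.*-zeroˡ (b (suc n))) ⟩
  0ℚ + ∑[ i < suc n ] (shiftBy k a i * b (n ∸ i))                      ≡⟨ ℚ.+-identityˡ _ ⟩
  ∑[ i < suc n ] (shiftBy k a i * b (n ∸ i))                           ≡⟨ ⊛-def (shiftBy k a) b n ⟨
  (shiftBy k a ⊛ b) n                                                  ≡⟨ shiftBy-⊛ˡ k a b n ⟩
  shiftBy k (a ⊛ b) n                                                  ∎
  where open ≡-Reasoning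

shiftBy-⊛ʳ : ∀ k a b → a ⊛ shiftBy k b ≐ shiftBy k (a ⊛ b)
shiftBy-⊛ʳ k a b n = begin
  (a ⊛ shiftBy k b) n   ≡⟨ ⊛-comm a (shiftBy k b) n ⟩
  (shiftBy k b ⊛ a) n   ≡⟨ shiftBy-⊛ˡ k b a n ⟩
  shiftBy k (b ⊛ a) n   ≡⟨ shiftBy-cong k (⊛-comm b a) n ⟩
  shiftBy k (a ⊛ b) n   ∎
  where open ≡-Reasoning

shiftBy-suc : ∀ k a → shiftBy 1 (shiftBy k a) ≐ shiftBy (suc k) a
shiftBy-suc k a zero    = refl
shiftBy-suc k a (suc n) = refl

shiftBy-^S : ∀ a k → shiftBy 1 a ^S k ≐ shiftBy k (a ^S k)
shiftBy-^S a zero    n = refl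
shiftBy-^S a (suc k) n = begin
  (shiftBy 1 a ⊛ (shiftBy 1 a ^S k)) n      ≡⟨ ⊛-cong {shiftBy 1 a} (λ _ → refl) (shiftBy-^S a k) n ⟩
  (shiftBy 1 a ⊛ shiftBy k (a ^S k)) n      ≡⟨ shiftBy-⊛ˡ 1 a (shiftBy k (a ^S k)) n ⟩
  shiftBy 1 (a ⊛ shiftBy k (a ^S k)) n      ≡⟨ shiftBy-cong 1 (shiftBy-⊛ʳ k a (a ^S k)) n ⟩
  shiftBy 1 (shiftBy k (a ^S suc k)) n      ≡⟨ shiftBy-suc k (a ^S suc k) n ⟩
  shiftBy (suc k) (a ^S suc k) n            ∎
  where open ≡-Reasoning

E : Series
E = expm1OverT

T : Series
T = tOverExpm1

-- U = e^t − 1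
U : Series
U = shiftBy 1 E

factorial-U : ∀ m → ℕ→ℚ (suc m !) * U (suc m) ≡ 1ℚ
factorial-U m = trans (ℚ.*-comm (ℕ→ℚ (suc m !)) (E m)) (/-*-cancel 1 (suc m !))
  where instance _ = suc m ℕ.!≢0

factorial-U^S : ∀ k n → ℕ→ℚ (n !) * (U ^S k) n ≡ ℕ→ℚ (k !) * Sℚ n k
factorial-U^S zero    zero    = refl
factorial-U^S zero    (suc n) = ℚ.*-zeroʳ (ℕ→ℚ (suc n !))
factorial-U^S (suc k) n = begin
  ℕ→ℚ (n !) * (U ⊛ (U ^S k)) n                                        ≡⟨ cong (ℕ→ℚ (n !) *_) (⊛-comm U (U ^S k) n) ⟩
  ℕ→ℚ (n !) * ((U ^S k) ⊛ U) n                                        ≡⟨ factorial-⊛ (U ^S k) U n ⟩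
  ∑[ i < suc n ] (Cℚ n i * (ℕ→ℚ (i !) * (U ^S k) i) * Û (n ∸ i))      ≡⟨ ∑-cong (suc n) (λ i _ → cong (λ x → Cℚ n i * x * Û (n ∸ i)) (factorial-U^S k i)) ⟩
  ∑[ i < n ] (Cℚ n i * (k! * Sℚ i k) * Û (n ∸ i)) + last              ≡⟨ cong₂ _+_ (∑-cong n below) (cong (Cℚ n n * (k! * Sℚ n k) *_) (cong Û (ℕ.n∸n≡0 n))) ⟩
  ∑[ i < n ] (k! * (Cℚ n i * Sℚ i k)) + Cℚ n n * (k! * Sℚ n k) * 0ℚ  ≡⟨ cong₂ _+_ (∑-*ˡ n k! _) (ℚ.*-zeroʳ (Cℚ n n * (k! * Sℚ n k))) ⟩
  k! * ∑[ i < n ] (Cℚ n i * Sℚ i k) + 0ℚ                              ≡⟨ ℚ.+-identityʳ _ ⟩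
  k! * ∑[ i < n ] (Cℚ n i * Sℚ i k)                                   ≡⟨ cong (k! *_) (Sℚ-binomialSum-below n k) ⟨
  k! * (ℕ→ℚ (suc k) * Sℚ n (suc k))                                   ≡⟨ ℚ.*-assoc k! (ℕ→ℚ (suc k)) (Sℚ n (suc k)) ⟨
  k! * ℕ→ℚ (suc k) * Sℚ n (suc k)                                     ≡⟨ cong (_* Sℚ n (suc k)) (ℕ→ℚ-* (k !) (suc k)) ⟨
  ℕ→ℚ (k ! ℕ.* suc k) * Sℚ n (suc k)                                  ≡⟨ cong (λ m → ℕ→ℚ m * Sℚ n (suc k)) (ℕ.*-comm (k !) (suc k)) ⟩
  ℕ→ℚ (suc k !) * Sℚ n (suc k)                                        ∎
  where
  open ≡-Reasoning
  k! = ℕ→ℚ (k !)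
  Û : ℕ → ℚ
  Û m = ℕ→ℚ (m !) * U m
  last = Cℚ n n * (k! * Sℚ n k) * Û (n ∸ n)
  below : ∀ i → i < n → Cℚ n i * (k! * Sℚ i k) * Û (n ∸ i) ≡ k! * (Cℚ n i * Sℚ i k)
  below i i<n = begin
    Cℚ n i * (k! * Sℚ i k) * Û (n ∸ i)   ≡⟨ cong (Cℚ n i * (k! * Sℚ i k) *_) (trans (cong Û (ℕ.+-∸-assoc 1 i<n)) (factorial-U (n ∸ suc i))) ⟩
    Cℚ n i * (k! * Sℚ i k) * 1ℚ          ≡⟨ solve 3 (λ c f s → c :* (f :* s) :* con 1ℚ := f :* (c :* s)) refl (Cℚ n i) k! (Sℚ i k) ⟩
    k! * (Cℚ n i * Sℚ i k)               ∎

factorial-E^S : ∀ {k n} → k ≤ n → ℕ→ℚ (n !) * (E ^S k) (n ∸ k) ≡ ℕ→ℚ (k !) * Sℚ n k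
factorial-E^S {k} {n} k≤n = begin
  ℕ→ℚ (n !) * (E ^S k) (n ∸ k)          ≡⟨ cong (ℕ→ℚ (n !) *_) (shiftBy-≥ k (E ^S k) k≤n) ⟨
  ℕ→ℚ (n !) * shiftBy k (E ^S k) n      ≡⟨ cong (ℕ→ℚ (n !) *_) (shiftBy-^S E k n) ⟨
  ℕ→ℚ (n !) * (U ^S k) n                ≡⟨ factorial-U^S k n ⟩
  ℕ→ℚ (k !) * Sℚ n k                    ∎
  where open ≡-Reasoning

stirlingBernoulliSummand : ℕ → ℕ → ℕ → ℕ → ℚ
stirlingBernoulliSummand r n j k = ℕ→ℚ ((n ℕ.+ r) C (k ℕ.+ r)) * ℕ→ℚ (stirling2 (k ℕ.+ r) (j ℕ.+ r)) * bernoulliHO r (n ∸ k)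

stirlingBernoulliSum : ℕ → ℕ → ℕ → ℚ
stirlingBernoulliSum r n j = sumFromTo j n (stirlingBernoulliSummand r n j)

binomialRatio : ℕ → ℕ → ℕ → ℚ
binomialRatio r n j = ((+ ((n ℕ.+ r) C r)) / ((j ℕ.+ r) C r)) {{binomNonZero j r}}

stirlingBernoulliSum-factorial : ∀ r {n j} → j ≤ n →
  stirlingBernoulliSum r n j * ℕ→ℚ ((j ℕ.+ r) !) ≡ ℕ→ℚ ((n ℕ.+ r) !) * (E ^S j) (n ∸ j)
stirlingBernoulliSum-factorial r {n} {j} j≤n = begin
  sumFromTo j n F * K!                                    ≡⟨ cong (_* K!) (sumFromTo≡∑ j n F) ⟩
  ∑ (suc n ∸ j) (λ i → F (j ℕ.+ i)) * K!                  ≡⟨ cong (λ m → ∑ m (λ i → F (j ℕ.+ i)) * K!) (ℕ.+-∸-assoc 1 j≤n) ⟩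
  ∑[ i < suc d ] F (j ℕ.+ i) * K!                         ≡⟨ ∑-*ʳ (suc d) K! _ ⟨
  ∑[ i < suc d ] (F (j ℕ.+ i) * K!)                       ≡⟨ ∑-cong (suc d) (λ i i<1+d → reindex i (ℕ.≤-pred i<1+d)) ⟩
  ∑[ i < suc d ] (N! * ((E ^S K) i * (T ^S r) (d ∸ i)))   ≡⟨ ∑-*ˡ (suc d) N! _ ⟩
  N! * ∑[ i < suc d ] ((E ^S K) i * (T ^S r) (d ∸ i))     ≡⟨ cong (N! *_) (⊛-def (E ^S K) (T ^S r) d) ⟨
  N! * ((E ^S K) ⊛ (T ^S r)) d                            ≡⟨ cong (N! *_) (^S-inverse-cancel (⊛-invS E refl) j r d) ⟩
  N! * (E ^S j) d                                         ∎
  where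
  open ≡-Reasoning
  d = n ∸ j
  K = j ℕ.+ r
  N = n ℕ.+ r
  K! = ℕ→ℚ (K !)
  N! = ℕ→ℚ (N !)
  F = stirlingBernoulliSummand r n j
  summand : ∀ k → j ≤ k → k ≤ n → F k * K! ≡ N! * ((E ^S K) (k ∸ j) * (T ^S r) (n ∸ k))
  summand k j≤k k≤n = begin
    c * s * (ℕ→ℚ ((n ∸ k) !) * t) * K!            ≡⟨ solve 5 (λ c s p t q → c :* s :* (p :* t) :* q := c :* (q :* s) :* (p :* t))
                                                            refl c s (ℕ→ℚ ((n ∸ k) !)) t K! ⟩
    c * (K! * s) * (ℕ→ℚ ((n ∸ k) !) * t)          ≡⟨ cong (λ x → c * x * (ℕ→ℚ ((n ∸ k) !) * t)) (factorial-E^S K≤I) ⟨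
    c * (ℕ→ℚ (I !) * (E ^S K) (I ∸ K)) * (ℕ→ℚ ((n ∸ k) !) * t)
      ≡⟨ cong₂ (λ a b → c * (ℕ→ℚ (I !) * (E ^S K) a) * (ℕ→ℚ (b !) * t))
               ([m+o]∸[n+o]≡m∸n k j r) (sym ([m+o]∸[n+o]≡m∸n n k r)) ⟩
    c * (ℕ→ℚ (I !) * e) * (ℕ→ℚ ((N ∸ I) !) * t)   ≡⟨ factorials-split (ℕ.+-monoˡ-≤ r k≤n) e t ⟨
    N! * (e * t)                                   ∎
    where
    I = k ℕ.+ r
    c = ℕ→ℚ (N C I)
    s = ℕ→ℚ (stirling2 I K)
    t = (T ^S r) (n ∸ k)
    e = (E ^S K) (k ∸ j)
    K≤I : K ≤ I
    K≤I = ℕ.+-monoˡ-≤ r j≤k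
  reindex : ∀ i → i ≤ d → F (j ℕ.+ i) * K! ≡ N! * ((E ^S K) i * (T ^S r) (d ∸ i))
  reindex i i≤d = begin
    F (j ℕ.+ i) * K!                                                 ≡⟨ summand (j ℕ.+ i) (ℕ.m≤m+n j i) j+i≤n ⟩
    N! * ((E ^S K) (j ℕ.+ i ∸ j) * (T ^S r) (n ∸ (j ℕ.+ i)))         ≡⟨ cong₂ (λ a b → N! * ((E ^S K) a * (T ^S r) b))
                                                                               (ℕ.m+n∸m≡n j i) (sym (ℕ.∸-+-assoc n j i)) ⟩
    N! * ((E ^S K) i * (T ^S r) (d ∸ i))                             ∎
    where
    j+i≤n : j ℕ.+ i ≤ n
    j+i≤n = ℕ.≤-trans (ℕ.+-monoʳ-≤ j i≤d) (ℕ.≤-reflexive (ℕ.m+[n∸m]≡n j≤n))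

binomialRatio-factorials : ∀ r n j → binomialRatio r n j * ℕ→ℚ ((j ℕ.+ r) !) * ℕ→ℚ (n !) ≡ ℕ→ℚ ((n ℕ.+ r) !) * ℕ→ℚ (j !)
binomialRatio-factorials r n j = begin
  q * ℕ→ℚ ((j ℕ.+ r) !) * n!                 ≡⟨ cong (λ x → q * x * n!) (binomial-factorials-+ j r) ⟨
  q * (B * (r! * j!)) * n!                   ≡⟨ solve 5 (λ q b r j n → q :* (b :* (r :* j)) :* n := q :* b :* (r :* n) :* j) refl q B r! j! n! ⟩
  q * B * (r! * n!) * j!                     ≡⟨ cong (λ x → x * (r! * n!) * j!) (/-*-cancel ((n ℕ.+ r) C r) ((j ℕ.+ r) C r) {{binomNonZero j r}}) ⟩
  Cℚ (n ℕ.+ r) r * (r! * n!) * j!            ≡⟨ cong (_* j!) (binomial-factorials-+ n r) ⟩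
  ℕ→ℚ ((n ℕ.+ r) !) * j!                     ∎
  where
  open ≡-Reasoning
  q = binomialRatio r n j
  B = Cℚ (j ℕ.+ r) r
  r! = ℕ→ℚ (r !)
  j! = ℕ→ℚ (j !)
  n! = ℕ→ℚ (n !)

stirlingBernoulliSum-≤ : ∀ r {n j} → j ≤ n → stirlingBernoulliSum r n j ≡ binomialRatio r n j * Sℚ n j
stirlingBernoulliSum-≤ r {n} {j} j≤n =
  *-cancelʳ-ℕ→ℚ L R ((j ℕ.+ r) !) {{(j ℕ.+ r) ℕ.!≢0}}
    (*-cancelʳ-ℕ→ℚ (L * K!) (R * K!) (n !) {{n ℕ.!≢0}} (begin
      L * K! * n!                      ≡⟨ cong (_* n!) (stirlingBernoulliSum-factorial r j≤n) ⟩
      N! * (E ^S j) (n ∸ j) * n!       ≡⟨ solve 3 (λ a e b → a :* e :* b := a :* (b :* e)) refl N! ((E ^S j) (n ∸ j)) n! ⟩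
      N! * (n! * (E ^S j) (n ∸ j))     ≡⟨ cong (N! *_) (factorial-E^S j≤n) ⟩
      N! * (ℕ→ℚ (j !) * Sℚ n j)        ≡⟨ ℚ.*-assoc N! (ℕ→ℚ (j !)) (Sℚ n j) ⟨
      N! * ℕ→ℚ (j !) * Sℚ n j          ≡⟨ cong (_* Sℚ n j) (binomialRatio-factorials r n j) ⟨
      q * K! * n! * Sℚ n j             ≡⟨ solve 4 (λ q k n s → q :* k :* n :* s := q :* s :* k :* n) refl q K! n! (Sℚ n j) ⟩
      R * K! * n!                      ∎))
  where
  open ≡-Reasoning
  L = stirlingBernoulliSum r n j
  q = binomialRatio r n j
  R = q * Sℚ n j
  K! = ℕ→ℚ ((j ℕ.+ r) !)
  N! = ℕ→ℚ ((n ℕ.+ r) !)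
  n! = ℕ→ℚ (n !)

stirlingBernoulliSum-> : ∀ r {n j} → n < j → stirlingBernoulliSum r n j ≡ binomialRatio r n j * Sℚ n j
stirlingBernoulliSum-> r {n} {j} n<j = begin
  sumFromTo j n F                             ≡⟨ sumFromTo≡∑ j n F ⟩
  ∑[ i < suc n ∸ j ] F (j ℕ.+ i)              ≡⟨ cong (λ m → ∑[ i < m ] F (j ℕ.+ i)) (ℕ.m≤n⇒m∸n≡0 n<j) ⟩
  0ℚ                                          ≡⟨ ℚ.*-zeroʳ (binomialRatio r n j) ⟨
  binomialRatio r n j * 0ℚ                    ≡⟨ cong (λ s → binomialRatio r n j * ℕ→ℚ s) (stirling2-< n<j) ⟨
  binomialRatio r n j * Sℚ n j                ∎
  where
  open ≡-Reasoning
  F = stirlingBernoulliSummand r n j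

stirlingBernoulliSum≡ : ∀ r n j → stirlingBernoulliSum r n j ≡ binomialRatio r n j * Sℚ n j
stirlingBernoulliSum≡ r n j with j ≤? n
... | yes j≤n = stirlingBernoulliSum-≤ r j≤n
... | no  j≰n = stirlingBernoulliSum-> r (ℕ.≰⇒> j≰n)

stirlingBernoulliSum-1 : ∀ n j → stirlingBernoulliSum 1 n j
  ≡ sumFromTo j n (λ k → ℕ→ℚ (suc n C suc k) * ℕ→ℚ (stirling2 (suc k) (suc j)) * bernoulli (n ∸ k))
stirlingBernoulliSum-1 n j = sumFromTo-cong j n λ k → +1≡suc k
  where
  +1≡suc : ∀ k → ℕ→ℚ ((n ℕ.+ 1) C (k ℕ.+ 1)) * ℕ→ℚ (stirling2 (k ℕ.+ 1) (j ℕ.+ 1)) * bernoulli (n ∸ k)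
                ≡ ℕ→ℚ (suc n C suc k) * ℕ→ℚ (stirling2 (suc k) (suc j)) * bernoulli (n ∸ k)
  +1≡suc k rewrite ℕ.+-comm n 1 | ℕ.+-comm k 1 | ℕ.+-comm j 1 = refl

binomialRatio-1 : ∀ n j → binomialRatio 1 n j ≡ (+ suc n) / suc j
binomialRatio-1 n j = /-cong {{binomNonZero j 1}} (trans (ℕC.nC1≡n (n ℕ.+ 1)) (ℕ.+-comm n 1))
                                                   (trans (ℕC.nC1≡n (j ℕ.+ 1)) (ℕ.+-comm j 1))

mainTheorem17 : ((r : ℕ) → .{{_ : NonZero r}} → (n j : ℕ) →
                    sumFromTo j n (λ k → ℕ→ℚ ((n Data.Nat.+ r) C (k Data.Nat.+ r))
                                         * ℕ→ℚ (stirling2 (k Data.Nat.+ r) (j Data.Nat.+ r))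
                                         * bernoulliHO r (n ∸ k))
                    ≡ ((+ ((n Data.Nat.+ r) C r)) / ((j Data.Nat.+ r) C r)) {{binomNonZero j r}}
                      * ℕ→ℚ (stirling2 n j))
                  × ((n j : ℕ) →
                    sumFromTo j n (λ k → ℕ→ℚ (suc n C suc k)
                                         * ℕ→ℚ (stirling2 (suc k) (suc j))
                                         * bernoulli (n ∸ k))
                    ≡ ((+ suc n) / suc j) * ℕ→ℚ (stirling2 n j))
mainTheorem17 = (λ r n j → stirlingBernoulliSum≡ r n j) , λ n j → begin
  _                                  ≡⟨ stirlingBernoulliSum-1 n j ⟨
  stirlingBernoulliSum 1 n j         ≡⟨ stirlingBernoulliSum≡ 1 n j ⟩
  binomialRatio 1 n j * Sℚ n j       ≡⟨ cong (_* Sℚ n j) (binomialRatio-1 n j) ⟩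
  (+ suc n) / suc j * Sℚ n j         ∎
  where open ≡-Reasoning
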